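{- Let $\leq_1$ and $\leq_2$ be transitive relations on a finite nonempty set $S$ and let $\leq_3:=\leq_1\cap\leq_2$ (i.e., $s\leq_3 t$ iff $s\leq_1 t$ and $s\leq_2 t$). Then $\leq_3$ is transitive and $\mathrm{mcl}(\leq_3)\leq\mathrm{mcl}(\leq_1)+\mathrm{mcl}(\leq_2)$.
   Context: For a relation $\leq$, $s<t$ means ($s\leq t$ and not $t\leq s$). For a transitive relation $\leq$ on a finite nonempty set $S$, $\mathrm{mcl}(\leq)$ is the largest $l\in\mathbb{N}$ such that there exist $s_0,\dots,s_l\in S$ with $s_0<s_1<\dots<s_l$. -}

module Defs where

open import Level using (Level; _⊔_; suc)
open import Data.Nat using (ℕ; _≤_)
open import Data.Fin using (Fin; inject₁) renaming (suc to fsuc)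
open import Data.Product using (_×_; Σ)
open import Relation.Nullary using (¬_)
open import Relation.Binary.Core using (Rel)
open import Relation.Binary.Definitions using (Transitive)

Strict : ∀ {a ℓ} {A : Set a} → Rel A ℓ → Rel A ℓ
Strict R s t = R s t × ¬ R t s

-- a strict chain s₀ < s₁ < … < s_l of length l (l+1 elements)
Chain : ∀ {a ℓ} {A : Set a} → Rel A ℓ → ℕ → Set (a ⊔ ℓ)
Chain {A = A} R l =
  Σ (Fin (Data.Nat.suc l) → A) λ s → (i : Fin l) → Strict R (s (inject₁ i)) (s (fsuc i))

IsMcl : ∀ {a ℓ} {A : Set a} → Rel A ℓ → ℕ → Set (a ⊔ ℓ)
IsMcl R l = Chain R l × (∀ m → Chain R m → m ≤ l)

_∩_ : ∀ {a ℓ₁ ℓ₂} {A : Set a} → Rel A ℓ₁ → Rel A ℓ₂ → Rel A (ℓ₁ ⊔ ℓ₂)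
(R₁ ∩ R₂) s t = R₁ s t × R₂ s t

module Submission where

-- For the bound on
-- chain lengths, take a strict ≤₃-chain s₀ <₃ s₁ <₃ … <₃ s_L.  Each step
-- sᵢ <₃ sᵢ₊₁ is weak in both relations and, since ¬(sᵢ₊₁ ≤₁ sᵢ ∧ sᵢ₊₁ ≤₂ sᵢ),
-- strict in at least one of them.  Walking the chain backwards we maintain,
-- for the current element x, a strict ≤₁-chain and a strict ≤₂-chain whose
-- heads lie weakly above x and whose lengths add up to the number of steps
-- walked: a step strict in ≤ⱼ prepends x to the ≤ⱼ-chain, and the other chain
-- is kept (its head is still above x by transitivity).  So L = k₁ + k₂ with
-- strict chains of lengths k₁ and k₂, whence L ≤ mcl(≤₁) + mcl(≤₂).
--
-- The relations are not assumed decidable, so "strict in one of them" only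
-- holds up to double negation; the splitting is therefore established in
-- the double-negation monad and escaped at the end because ≤ on ℕ is
-- decidable.

open import Defs
open import Level using (Level; 0ℓ; _⊔_)
open import Data.Nat using (ℕ; zero; suc; _≤_; _+_)
open import Data.Nat.Properties using (_≤?_; +-mono-≤; +-suc)
open import Data.Fin using (Fin) renaming (zero to fzero; suc to fsuc)
open import Data.Vec.Functional using (_∷_)
open import Data.Product using (_×_; _,_; Σ; ∃₂)
open import Relation.Nullary using (¬_)
open import Relation.Nullary.Negation using (DoubleNegation; ¬¬-map; negated-stable)
open import Relation.Nullary.Decidable using (decidable-stable)
open import Relation.Binary.Core using (Rel)
open import Relation.Binary.Definitions using (Transitive)
open import Relation.Binary.Construct.Closure.Reflexive using (ReflClosure; refl; [_])
open import Relation.Binary.PropositionalEquality using (_≡_; cong; sym; trans; subst)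
  renaming (refl to ≡-refl)

private
  variable
    a ℓ ℓ₁ ℓ₂ : Level
    A : Set a

∩-transitive : {R₁ : Rel A ℓ₁} {R₂ : Rel A ℓ₂} →
  Transitive R₁ → Transitive R₂ → Transitive (R₁ ∩ R₂)
∩-transitive trans₁ trans₂ (x₁y , x₂y) (y₁z , y₂z) = trans₁ x₁y y₁z , trans₂ x₂y y₂z

head : {R : Rel A ℓ} {k : ℕ} → Chain R k → A
head (s , _) = s fzero

tail : {R : Rel A ℓ} {k : ℕ} → Chain R (suc k) → Chain R k
tail (s , steps) = (λ i → s (fsuc i)) , (λ i → steps (fsuc i))

cons : {R : Rel A ℓ} {k : ℕ} (x : A) (c : Chain R k) → Strict R x (head {R = R} c) → Chain R (suc k)
cons x (s , steps) x<s₀ = (x ∷ s) , λ { fzero → x<s₀ ; (fsuc i) → steps i }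

singleton : {R : Rel A ℓ} → A → Chain R 0
singleton x = (λ _ → x) , λ ()

ChainAbove : {A : Set a} → Rel A ℓ → A → ℕ → Set (a ⊔ ℓ)
ChainAbove R x k = Σ (Chain R k) λ c → ReflClosure R x (head {R = R} c)

module _ {R : Rel A ℓ} (trans-R : Transitive R) where

  ≤-then-≤⁼ : {x y z : A} → R x y → ReflClosure R y z → R x z
  ≤-then-≤⁼ xy refl   = xy
  ≤-then-≤⁼ xy [ yz ] = trans-R xy yz

  ≤⁼-then-≤ : {x y z : A} → ReflClosure R x y → R y z → R x z
  ≤⁼-then-≤ refl   yz = yz
  ≤⁼-then-≤ [ xy ] yz = trans-R xy yz

  above-strict : {x x' : A} {k : ℕ} → Strict R x x' → ChainAbove R x' k → ChainAbove R x (suc k)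
  above-strict {x} (xx' , ¬x'x) (c , x'≤⁼c) =
    cons {R = R} x c (≤-then-≤⁼ xx' x'≤⁼c , λ cx → ¬x'x (≤⁼-then-≤ x'≤⁼c cx)) , refl

  above-weak : {x x' : A} {k : ℕ} → R x x' → ChainAbove R x' k → ChainAbove R x k
  above-weak xx' (c , x'≤⁼c) = c , [ ≤-then-≤⁼ xx' x'≤⁼c ]

Split : {A : Set a} → Rel A ℓ₁ → Rel A ℓ₂ → A → ℕ → Set (a ⊔ ℓ₁ ⊔ ℓ₂)
Split R₁ R₂ x L = ∃₂ λ k₁ k₂ → L ≡ k₁ + k₂ × ChainAbove R₁ x k₁ × ChainAbove R₂ x k₂

module _ {R₁ : Rel A ℓ₁} {R₂ : Rel A ℓ₂} (trans₁ : Transitive R₁) (trans₂ : Transitive R₂) where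

  -- Classically the step is
  -- strict in R₁ or in R₂.  Constructively, given ¬ Split: if x' R₁ x held,
  -- the step would be strict in R₂ and via-R₂ would give a contradiction;
  -- so ¬ x' R₁ x, the step is strict in R₁, and via-R₁ contradicts.
  split-step : {x x' : A} {L : ℕ} → Strict (R₁ ∩ R₂) x x' →
    Split R₁ R₂ x' L → DoubleNegation (Split R₁ R₂ x (suc L))
  split-step {x} {x'} {L} ((x₁x' , x₂x') , ¬x'x) (k₁ , k₂ , L≡ , c₁ , c₂) ¬split =
    ¬split (via-R₁ ¬x'₁x)
    where
    via-R₁ : ¬ R₁ x' x → Split R₁ R₂ x (suc L)
    via-R₁ ¬x'₁x = suc k₁ , k₂ , cong suc L≡ ,
      above-strict {R = R₁} trans₁ (x₁x' , ¬x'₁x) c₁ , above-weak {R = R₂} trans₂ x₂x' c₂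

    via-R₂ : ¬ R₂ x' x → Split R₁ R₂ x (suc L)
    via-R₂ ¬x'₂x = k₁ , suc k₂ , trans (cong suc L≡) (sym (+-suc k₁ k₂)) ,
      above-weak {R = R₁} trans₁ x₁x' c₁ , above-strict {R = R₂} trans₂ (x₂x' , ¬x'₂x) c₂

    ¬x'₁x : ¬ R₁ x' x
    ¬x'₁x x'₁x = ¬split (via-R₂ λ x'₂x → ¬x'x (x'₁x , x'₂x))

  split : {L : ℕ} (c : Chain (R₁ ∩ R₂) L) → DoubleNegation (Split R₁ R₂ (head {R = R₁ ∩ R₂} c) L)
  split {zero}  (s , _) ¬split =
    ¬split (0 , 0 , ≡-refl ,
            (singleton {R = R₁} (s fzero) , refl) , (singleton {R = R₂} (s fzero) , refl))
  -- Split the tail, then prepend the first step (a bind in the ¬¬ monad).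
  split {suc L} c@(_ , steps) =
    negated-stable (¬¬-map (split-step (steps fzero)) (split (tail {R = R₁ ∩ R₂} c)))

  ∩-chain-bound : {l₁ l₂ L : ℕ} →
    (∀ m → Chain R₁ m → m ≤ l₁) → (∀ m → Chain R₂ m → m ≤ l₂) →
    Chain (R₁ ∩ R₂) L → L ≤ l₁ + l₂
  ∩-chain-bound {l₁} {l₂} {L} bound₁ bound₂ c =
    decidable-stable (L ≤? l₁ + l₂) (¬¬-map bound (split c))
    where
    bound : Split R₁ R₂ (head {R = R₁ ∩ R₂} c) L → L ≤ l₁ + l₂
    bound (k₁ , k₂ , L≡ , (c₁ , _) , (c₂ , _)) =
      subst (_≤ l₁ + l₂) (sym L≡) (+-mono-≤ (bound₁ k₁ c₁) (bound₂ k₂ c₂))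

lemma4p9 : (n : ℕ) (R₁ R₂ : Rel (Fin (suc n)) 0ℓ) →
    Transitive R₁ → Transitive R₂ →
    Transitive (R₁ ∩ R₂) ×
    (∀ l₁ l₂ l₃ → IsMcl R₁ l₁ → IsMcl R₂ l₂ → IsMcl (R₁ ∩ R₂) l₃ → l₃ ≤ l₁ + l₂)
lemma4p9 n R₁ R₂ trans₁ trans₂ =
  ∩-transitive {R₁ = R₁} {R₂ = R₂} trans₁ trans₂ ,
  λ l₁ l₂ l₃ (_ , maximal₁) (_ , maximal₂) (chain₃ , _) →
    ∩-chain-bound {R₁ = R₁} {R₂ = R₂} trans₁ trans₂ maximal₁ maximal₂ chain₃
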